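{- Let $E$ be a finite set, let $T$ be a PQ-tree whose leaves are the elements of $E$, and let $\vartriangleleft$ be a partial ordering of $E$. Let $S$ be a subtree of $T$ (an inner node of $T$ together with all its descendants). Suppose that there exists a reordering $T'$ of $T$ compatible with $\vartriangleleft$. Then for every local reordering of $S$ compatible with $\vartriangleleft$ (i.e. every reordering $S'$ of $S$, obtained by applying reordering operations to the inner nodes of $S$, such that the left-to-right order of the leaves of $S'$ extends the restriction of $\vartriangleleft$ to the leaves of $S$), there exists a reordering $T''$ of $T$ compatible with $\vartriangleleft$ in which the leaves of $S$ appear in the same relative order as in $S'$.
   Context: A PQ-tree on a finite set $E$ is a rooted tree whose leaves correspond one-to-one to the elements of $E$, whose inner nodes are of two types (P-nodes and Q-nodes), each inner node has at least two children, and the children of every inner node are linearly ordered. A PQ-tree $T$ represents the linear ordering $<_T$ of $E$ given by reading the leaves from left to right. Reordering operations: the children of a P-node may be permuted arbitrarily; the order of the children of a Q-node may only be reversed. A tree $T'$ is a reordering of $T$ if it is obtained from $T$ by applying several reordering operations. A reordering $T'$ of $T$ is compatible with a partial ordering $\vartriangleleft$ of $E$ if $a \vartriangleleft b$ implies $a <_{T'} b$ for all $a,b\in E$. -}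

module Defs where

open import Data.Nat using (ℕ; _≤_)
open import Data.Fin using (Fin)
open import Data.List using (List; []; _∷_; _++_; length; reverse; allFin)
open import Data.List.Membership.Propositional using (_∈_)
open import Data.List.Relation.Binary.Permutation.Propositional using (_↭_)
open import Data.Product using (Σ; ∃; _×_; _,_)
open import Relation.Binary.PropositionalEquality using (_≡_)
open import Relation.Binary.Construct.Closure.ReflexiveTransitive using (Star)

data Kind : Set where
  P Q : Kind

data PQTree (n : ℕ) : Set where
  leaf : Fin n → PQTree n
  node : Kind → (cs : List (PQTree n)) → 2 ≤ length cs → PQTree n

mutual
  frontier : ∀ {n} → PQTree n → List (Fin n)
  frontier (leaf e) = e ∷ []
  frontier (node _ cs _) = frontiers cs

  frontiers : ∀ {n} → List (PQTree n) → List (Fin n)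
  frontiers [] = []
  frontiers (c ∷ cs) = frontier c ++ frontiers cs

IsPQTreeOn : ∀ {n} → PQTree n → Set
IsPQTreeOn {n} T = frontier T ↭ allFin n

data Step {n : ℕ} : PQTree n → PQTree n → Set where
  permute-P : ∀ {cs cs'} (p : 2 ≤ length cs) (p' : 2 ≤ length cs') →
              cs ↭ cs' → Step (node P cs p) (node P cs' p')
  reverse-Q : ∀ {cs} (p : 2 ≤ length cs) (p' : 2 ≤ length (reverse cs)) →
              Step (node Q cs p) (node Q (reverse cs) p')
  inside    : ∀ {k xs ys c c'} (p : 2 ≤ length (xs ++ c ∷ ys))
              (p' : 2 ≤ length (xs ++ c' ∷ ys)) →
              Step c c' → Step (node k (xs ++ c ∷ ys) p) (node k (xs ++ c' ∷ ys) p')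

Reordering : ∀ {n} → PQTree n → PQTree n → Set
Reordering T T' = Star Step T T'

Before : ∀ {n} → List (Fin n) → Fin n → Fin n → Set
Before {n} xs a b = Σ (List (Fin n)) λ us → Σ (List (Fin n)) λ vs →
  xs ≡ us ++ a ∷ vs × b ∈ vs

_<[_]_ : ∀ {n} → Fin n → PQTree n → Fin n → Set
a <[ T ] b = Before (frontier T) a b

Compatible : ∀ {n} → (Fin n → Fin n → Set) → PQTree n → Set
Compatible {n} _◁_ T = ∀ (a b : Fin n) → a ◁ b → a <[ T ] b

LocallyCompatible : ∀ {n} → (Fin n → Fin n → Set) → PQTree n → Set
LocallyCompatible {n} _◁_ S = ∀ (a b : Fin n) → a ∈ frontier S → b ∈ frontier S →
  a ◁ b → a <[ S ] b

data SubtreeOf {n : ℕ} : PQTree n → PQTree n → Set where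
  here  : ∀ {k cs} (p : 2 ≤ length cs) → SubtreeOf (node k cs p) (node k cs p)
  below : ∀ {S k cs c} (p : 2 ≤ length cs) → c ∈ cs → SubtreeOf S c →
          SubtreeOf S (node k cs p)

-- Write T = C[S] for a one-hole context C. A reordering operation applied to
-- C[X] acts either inside X or on C, and in the latter case it acts on C[Y]
-- in the same way for every Y; hence every reordering T' of T has the form
-- C'[S₁] with S₁ a reordering of S and C'[Y] a reordering of C[Y] for all Y.
-- Take T'' = C'[S']. The frontiers of T' and T'' are L ++ frontier S₁ ++ R
-- and L ++ frontier S' ++ R, where frontier S₁ and frontier S' are
-- permutations of each other: a constraint a ◁ b with both ends in the
-- middle block is respected by S', any other one is respected in T'' exactly
-- as in T'. As the leaves of T'' are distinct, the order of two leaves of S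
-- in T'' is their order inside the middle block, i.e. in S'.
module Submission where

open import Defs
open import Data.Nat using (ℕ; suc; _+_; _≤_)
open import Data.Nat.Properties using (≤-irrelevant)
open import Data.Fin using (Fin)
open import Data.Product using (Σ; _×_; _,_)
open import Data.Sum using (_⊎_; inj₁; inj₂)
open import Data.Empty using (⊥-elim)
open import Data.List using (List; []; _∷_; _++_; length; reverse; [_])
open import Data.List.Properties
  using (++-assoc; reverse-++; ++-identityʳ; ∷-injective; length-++; length-reverse)
open import Data.List.Membership.Propositional using (_∈_)
open import Data.List.Membership.Propositional.Properties
  using (∈-++⁺ˡ; ∈-++⁺ʳ; ∈-++⁻; ∈-∃++; ∈-insert)
open import Data.List.Relation.Unary.Any using (here; there)
import Data.List.Relation.Unary.All as All
open import Data.List.Relation.Unary.AllPairs using (_∷_)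
open import Data.List.Relation.Unary.Unique.Propositional using (Unique)
open import Data.List.Relation.Unary.Unique.Propositional.Properties using (allFin⁺)
open import Data.List.Relation.Binary.Disjoint.Propositional using (Disjoint)
open import Data.List.Relation.Binary.Permutation.Propositional
  using (_↭_; ↭-refl; ↭-sym; ↭-trans; ↭-prep; ↭⇒↭ₛ; module PermutationReasoning)
import Data.List.Relation.Binary.Permutation.Propositional as Perm
open import Data.List.Relation.Binary.Permutation.Propositional.Properties
  using (∈-resp-↭; ++⁺ˡ; ++⁺ʳ; ++-comm; drop-mid; shift; shifts)
open import Data.List.Relation.Binary.Permutation.Setoid.Properties using (Unique-resp-↭)
open import Relation.Binary.PropositionalEquality
  using (_≡_; refl; sym; trans; cong; cong₂; subst; setoid; module ≡-Reasoning)
open import Relation.Binary.Structures using (IsStrictPartialOrder)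
open import Relation.Binary.Construct.Closure.ReflexiveTransitive using (ε; _◅_; _◅◅_)
open import Function.Bundles using (_⇔_; mk⇔; Equivalence)

module _ {A : Set} where

  length-++-cong : (as as′ bs bs′ : List A) → length as ≡ length as′ → length bs ≡ length bs′ →
    length (as ++ bs) ≡ length (as′ ++ bs′)
  length-++-cong as as′ _ _ eq eq′ = trans (length-++ as) (trans (cong₂ _+_ eq eq′) (sym (length-++ as′)))

  length-++-∷ : (xs : List A) (z z′ : A) (ys : List A) →
    length (xs ++ z ∷ ys) ≡ length (xs ++ z′ ∷ ys)
  length-++-∷ xs z z′ ys = length-++-cong xs xs (z ∷ ys) (z′ ∷ ys) refl refl

  ++-≡-++-∷ : (X : List A) {Y us : List A} {a : A} {vs : List A} → X ++ Y ≡ us ++ a ∷ vs →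
    (Σ (List A) λ m → us ≡ X ++ m × Y ≡ m ++ a ∷ vs) ⊎
    (Σ (List A) λ m → X ≡ us ++ a ∷ m × vs ≡ m ++ Y)
  ++-≡-++-∷ [] {us = us} e = inj₁ (us , refl , e)
  ++-≡-++-∷ (x ∷ X) {us = []} refl = inj₂ (X , refl , refl)
  ++-≡-++-∷ (x ∷ X) {us = u ∷ us} e with ∷-injective e
  ... | refl , e′ with ++-≡-++-∷ X e′
  ... | inj₁ (m , refl , e″) = inj₁ (m , refl , e″)
  ... | inj₂ (m , refl , e″) = inj₂ (m , refl , e″)

  ++-∷-≡-++-∷ : (xs : List A) (z : A) (ys xs₀ : List A) (c : A) (ys₀ : List A) →
    xs ++ z ∷ ys ≡ xs₀ ++ c ∷ ys₀ →
    (xs ≡ xs₀ × z ≡ c × ys ≡ ys₀) ⊎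
    ((Σ (List A) λ m → xs₀ ≡ xs ++ z ∷ m × ys ≡ m ++ c ∷ ys₀) ⊎
     (Σ (List A) λ m → xs ≡ xs₀ ++ c ∷ m × ys₀ ≡ m ++ z ∷ ys))
  ++-∷-≡-++-∷ [] z ys [] c ys₀ refl = inj₁ (refl , refl , refl)
  ++-∷-≡-++-∷ [] z ys (x ∷ xs₀) c ys₀ refl = inj₂ (inj₁ (xs₀ , refl , refl))
  ++-∷-≡-++-∷ (x ∷ xs) z ys [] c ys₀ refl = inj₂ (inj₂ (xs , refl , refl))
  ++-∷-≡-++-∷ (x ∷ xs) z ys (x′ ∷ xs₀) c ys₀ e with ∷-injective e
  ... | refl , e′ with ++-∷-≡-++-∷ xs z ys xs₀ c ys₀ e′
  ... | inj₁ (refl , refl , refl) = inj₁ (refl , refl , refl)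
  ... | inj₂ (inj₁ (m , refl , refl)) = inj₂ (inj₁ (m , refl , refl))
  ... | inj₂ (inj₂ (m , refl , refl)) = inj₂ (inj₂ (m , refl , refl))

  reverse-++-∷ : (xs : List A) (z : A) (ys : List A) →
    reverse (xs ++ z ∷ ys) ≡ reverse ys ++ z ∷ reverse xs
  reverse-++-∷ xs z ys = begin
    reverse (xs ++ z ∷ ys)             ≡⟨ reverse-++ xs (z ∷ ys) ⟩
    reverse (z ∷ ys) ++ reverse xs     ≡⟨ cong (_++ reverse xs) (reverse-++ [ z ] ys) ⟩
    (reverse ys ++ [ z ]) ++ reverse xs ≡⟨ ++-assoc (reverse ys) [ z ] (reverse xs) ⟩
    reverse ys ++ z ∷ reverse xs       ∎
    where open ≡-Reasoning

  ↭-++-∷ : (xs ys us vs : List A) (z : A) → xs ++ ys ↭ us ++ vs → xs ++ z ∷ ys ↭ us ++ z ∷ vs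
  ↭-++-∷ xs ys us vs z ρ = ↭-trans (shift z xs ys) (↭-trans (↭-prep z ρ) (↭-sym (shift z us vs)))

node-cong : ∀ {n k} {cs cs′ : List (PQTree n)} {p q} → cs ≡ cs′ → node k cs p ≡ node k cs′ q
node-cong {p = p} {q} refl = cong (node _ _) (≤-irrelevant p q)

node-injective : ∀ {n k k′} {cs cs′ : List (PQTree n)} {p q} →
  node k cs p ≡ node k′ cs′ q → k ≡ k′ × cs ≡ cs′
node-injective refl = refl , refl

reverse-Q-Reordering : ∀ {n} {cs cs′ : List (PQTree n)} {p p′} →
  cs′ ≡ reverse cs → Reordering (node Q cs p) (node Q cs′ p′)
reverse-Q-Reordering refl = reverse-Q _ _ ◅ ε

inside-Reordering : ∀ {n k} {xs ys cs cs′ : List (PQTree n)} {c c′ p p′} →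
  cs ≡ xs ++ c ∷ ys → cs′ ≡ xs ++ c′ ∷ ys → Step c c′ →
  Reordering (node k cs p) (node k cs′ p′)
inside-Reordering refl refl s = inside _ _ s ◅ ε

frontiers-++ : ∀ {n} (cs ds : List (PQTree n)) → frontiers (cs ++ ds) ≡ frontiers cs ++ frontiers ds
frontiers-++ [] ds = refl
frontiers-++ (c ∷ cs) ds = trans (cong (frontier c ++_) (frontiers-++ cs ds))
  (sym (++-assoc (frontier c) (frontiers cs) (frontiers ds)))

frontiers-↭ : ∀ {n} {cs cs′ : List (PQTree n)} → cs ↭ cs′ → frontiers cs ↭ frontiers cs′
frontiers-↭ Perm.refl = ↭-refl
frontiers-↭ (Perm.prep c σ) = ++⁺ˡ (frontier c) (frontiers-↭ σ)
frontiers-↭ (Perm.swap c d σ) =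
  ↭-trans (++⁺ˡ (frontier c) (++⁺ˡ (frontier d) (frontiers-↭ σ))) (shifts (frontier c) (frontier d))
frontiers-↭ (Perm.trans σ τ) = ↭-trans (frontiers-↭ σ) (frontiers-↭ τ)

frontiers-reverse : ∀ {n} (cs : List (PQTree n)) → frontiers cs ↭ frontiers (reverse cs)
frontiers-reverse [] = ↭-refl
frontiers-reverse (c ∷ cs) = begin
  frontier c ++ frontiers cs                  ↭⟨ ++-comm (frontier c) (frontiers cs) ⟩
  frontiers cs ++ frontier c                  ↭⟨ ++⁺ʳ (frontier c) (frontiers-reverse cs) ⟩
  frontiers (reverse cs) ++ frontier c        ≡⟨ cong (frontiers (reverse cs) ++_) (++-identityʳ (frontier c)) ⟨
  frontiers (reverse cs) ++ frontiers [ c ]   ≡⟨ frontiers-++ (reverse cs) [ c ] ⟨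
  frontiers (reverse cs ++ [ c ])             ≡⟨ cong frontiers (reverse-++ [ c ] cs) ⟨
  frontiers (reverse (c ∷ cs))                ∎
  where open PermutationReasoning

Step⇒frontier-↭ : ∀ {n} {X Y : PQTree n} → Step X Y → frontier X ↭ frontier Y
Step⇒frontier-↭ (permute-P _ _ σ) = frontiers-↭ σ
Step⇒frontier-↭ (reverse-Q {cs} _ _) = frontiers-reverse cs
Step⇒frontier-↭ (inside {xs = xs} {ys} {c} {c′} _ _ s) = begin
  frontiers (xs ++ c ∷ ys)                       ≡⟨ frontiers-++ xs (c ∷ ys) ⟩
  frontiers xs ++ frontier c ++ frontiers ys     ↭⟨ ++⁺ˡ (frontiers xs) (++⁺ʳ (frontiers ys) (Step⇒frontier-↭ s)) ⟩
  frontiers xs ++ frontier c′ ++ frontiers ys    ≡⟨ frontiers-++ xs (c′ ∷ ys) ⟨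
  frontiers (xs ++ c′ ∷ ys)                      ∎
  where open PermutationReasoning

Reordering⇒frontier-↭ : ∀ {n} {X Y : PQTree n} → Reordering X Y → frontier X ↭ frontier Y
Reordering⇒frontier-↭ ε = ↭-refl
Reordering⇒frontier-↭ (s ◅ r) = ↭-trans (Step⇒frontier-↭ s) (Reordering⇒frontier-↭ r)

IsPQTreeOn-Reordering : ∀ {n} {T T′ : PQTree n} → IsPQTreeOn T → Reordering T T′ → IsPQTreeOn T′
IsPQTreeOn-Reordering T-on r = ↭-trans (↭-sym (Reordering⇒frontier-↭ r)) T-on

IsPQTreeOn⇒Unique : ∀ {n} {T : PQTree n} → IsPQTreeOn T → Unique (frontier T)
IsPQTreeOn⇒Unique {n} T-on = Unique-resp-↭ (setoid (Fin n)) (↭⇒↭ₛ (↭-sym T-on)) (allFin⁺ n)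

-- The side condition of a context node holds whatever is plugged into the
-- hole, so it is stored as a function of the plugged tree.
data Context (n : ℕ) : Set where
  hole   : Context n
  within : Kind → (xs : List (PQTree n)) → Context n → (ys : List (PQTree n)) →
           (∀ z → 2 ≤ length (xs ++ z ∷ ys)) → Context n

plug : ∀ {n} → Context n → PQTree n → PQTree n
plug hole X = X
plug (within k xs C ys p) X = node k (xs ++ plug C X ∷ ys) (p (plug C X))

two≤-any : ∀ {n} (xs : List (PQTree n)) z ys → 2 ≤ length (xs ++ z ∷ ys) →
  ∀ z′ → 2 ≤ length (xs ++ z′ ∷ ys)
two≤-any xs z ys p z′ = subst (2 ≤_) (length-++-∷ xs z z′ ys) p

SubtreeOf⇒plug : ∀ {n} {S T : PQTree n} → SubtreeOf S T → Σ (Context n) λ C → T ≡ plug C S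
SubtreeOf⇒plug (here p) = hole , refl
SubtreeOf⇒plug (below {k = k} p c∈cs S⊆c) with ∈-∃++ c∈cs | SubtreeOf⇒plug S⊆c
... | xs , ys , refl | C , refl = within k xs C ys (two≤-any xs _ ys p) , node-cong refl

plug-Step : ∀ {n} (C : Context n) {X Y} → Step X Y → Step (plug C X) (plug C Y)
plug-Step hole s = s
plug-Step (within k xs C ys p) s = inside _ _ (plug-Step C s)

plug-Reordering : ∀ {n} (C : Context n) {X Y} → Reordering X Y → Reordering (plug C X) (plug C Y)
plug-Reordering C ε = ε
plug-Reordering C (s ◅ r) = plug-Step C s ◅ plug-Reordering C r

ContextReordering : ∀ {n} → Context n → Context n → Set
ContextReordering {n} C C′ = ∀ (Y : PQTree n) → Reordering (plug C Y) (plug C′ Y)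

record ReorderedPlug {n} (C : Context n) (X U : PQTree n) : Set where
  constructor reorderedPlug
  field
    context           : Context n
    content           : PQTree n
    ≡plug             : U ≡ plug context content
    content-reordered : Reordering X content
    context-reordered : ContextReordering C context

context-step : ∀ {n} {C : Context n} {X U} C′ → U ≡ plug C′ X → ContextReordering C C′ →
  ReorderedPlug C X U
context-step C′ eq r = reorderedPlug C′ _ eq ε r

module _ {n : ℕ} (xs : List (PQTree n)) (C : Context n) (ys : List (PQTree n))
         (p : ∀ z → 2 ≤ length (xs ++ z ∷ ys)) (X : PQTree n) where

  permute-P-ReorderedPlug : ∀ {cs′ q′} → xs ++ plug C X ∷ ys ↭ cs′ →
    ReorderedPlug (within P xs C ys p) X (node P cs′ q′)
  permute-P-ReorderedPlug {q′ = q′} σ with ∈-∃++ (∈-resp-↭ σ (∈-insert xs))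
  ... | us , vs , refl =
    context-step (within P us C vs (two≤-any us (plug C X) vs q′)) (node-cong refl)
      λ Y → permute-P _ _ (↭-++-∷ xs ys us vs (plug C Y) (drop-mid xs us σ)) ◅ ε

  reverse-Q-ReorderedPlug : ∀ {q′} →
    ReorderedPlug (within Q xs C ys p) X (node Q (reverse (xs ++ plug C X ∷ ys)) q′)
  reverse-Q-ReorderedPlug =
    context-step (within Q (reverse ys) C (reverse xs) two≤-reversed)
      (node-cong (reverse-++-∷ xs (plug C X) ys))
      λ Y → reverse-Q-Reordering (sym (reverse-++-∷ xs (plug C Y) ys))
    where
    two≤-reversed : ∀ z → 2 ≤ length (reverse ys ++ z ∷ reverse xs)
    two≤-reversed z = subst (2 ≤_)
      (trans (sym (length-reverse (xs ++ z ∷ ys))) (cong length (reverse-++-∷ xs z ys))) (p z)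

  inside-ReorderedPlug : ∀ {k X′ q′} → ReorderedPlug C X X′ →
    ReorderedPlug (within k xs C ys p) X (node k (xs ++ X′ ∷ ys) q′)
  inside-ReorderedPlug {k} (reorderedPlug C′ X₁ refl X↝X₁ C↝C′) =
    reorderedPlug (within k xs C′ ys p) X₁ (node-cong refl) X↝X₁
      λ Y → plug-Reordering (within k xs hole ys p) (C↝C′ Y)

module _ {n : ℕ} (k : Kind) (C : Context n) (X : PQTree n) {c c′ : PQTree n} (s : Step c c′) where

  right-sibling-ReorderedPlug : ∀ xs m ys {p q′} →
    ReorderedPlug (within k xs C (m ++ c ∷ ys) p) X (node k ((xs ++ plug C X ∷ m) ++ c′ ∷ ys) q′)
  right-sibling-ReorderedPlug xs m ys {p} =
    context-step (within k xs C (m ++ c′ ∷ ys) p′) (node-cong (++-assoc xs (plug C X ∷ m) (c′ ∷ ys)))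
      λ Y → inside-Reordering (sym (++-assoc xs (plug C Y ∷ m) (c ∷ ys)))
                              (sym (++-assoc xs (plug C Y ∷ m) (c′ ∷ ys))) s
    where
    p′ : ∀ z → 2 ≤ length (xs ++ z ∷ m ++ c′ ∷ ys)
    p′ z = subst (2 ≤_) (length-++-cong xs xs (z ∷ m ++ c ∷ ys) (z ∷ m ++ c′ ∷ ys) refl
      (cong suc (length-++-∷ m c c′ ys))) (p z)

  left-sibling-ReorderedPlug : ∀ xs m ys {p q′} →
    ReorderedPlug (within k (xs ++ c ∷ m) C ys p) X (node k (xs ++ c′ ∷ m ++ plug C X ∷ ys) q′)
  left-sibling-ReorderedPlug xs m ys {p} =
    context-step (within k (xs ++ c′ ∷ m) C ys p′) (node-cong (sym (++-assoc xs (c′ ∷ m) (plug C X ∷ ys))))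
      λ Y → inside-Reordering (++-assoc xs (c ∷ m) (plug C Y ∷ ys))
                              (++-assoc xs (c′ ∷ m) (plug C Y ∷ ys)) s
    where
    p′ : ∀ z → 2 ≤ length ((xs ++ c′ ∷ m) ++ z ∷ ys)
    p′ z = subst (2 ≤_) (length-++-cong (xs ++ c ∷ m) (xs ++ c′ ∷ m) (z ∷ ys) (z ∷ ys)
      (length-++-∷ xs c c′ m) refl) (p z)

Step⇒ReorderedPlug : ∀ {n} {U V : PQTree n} → Step U V → ∀ C X → plug C X ≡ U → ReorderedPlug C X V
Step⇒ReorderedPlug s hole X refl = reorderedPlug hole _ refl (s ◅ ε) (λ Y → ε)
Step⇒ReorderedPlug (permute-P _ _ σ) (within P xs C ys p) X refl =
  permute-P-ReorderedPlug xs C ys p X σ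
Step⇒ReorderedPlug (reverse-Q _ _) (within Q xs C ys p) X refl =
  reverse-Q-ReorderedPlug xs C ys p X
Step⇒ReorderedPlug (inside {xs = xs₀} {ys₀} {c} _ _ s) (within k xs C ys p) X e
  with node-injective e
... | refl , e′ with ++-∷-≡-++-∷ xs (plug C X) ys xs₀ c ys₀ e′
... | inj₁ (refl , refl , refl) = inside-ReorderedPlug xs C ys p X (Step⇒ReorderedPlug s C X refl)
... | inj₂ (inj₁ (m , refl , refl)) = right-sibling-ReorderedPlug k C X s xs m ys₀
... | inj₂ (inj₂ (m , refl , refl)) = left-sibling-ReorderedPlug k C X s xs₀ m ys

Reordering⇒ReorderedPlug : ∀ {n} (C : Context n) X {U} → Reordering (plug C X) U → ReorderedPlug C X U
Reordering⇒ReorderedPlug C X ε = reorderedPlug C X refl ε (λ Y → ε)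
Reordering⇒ReorderedPlug C X (s ◅ r) with Step⇒ReorderedPlug s C X refl
... | reorderedPlug C₁ X₁ refl X↝X₁ C↝C₁ with Reordering⇒ReorderedPlug C₁ X₁ r
... | reorderedPlug C₂ X₂ eq X₁↝X₂ C₁↝C₂ =
  reorderedPlug C₂ X₂ eq (X↝X₁ ◅◅ X₁↝X₂) λ Y → C↝C₁ Y ◅◅ C₁↝C₂ Y

leftFrontier rightFrontier : ∀ {n} → Context n → List (Fin n)
leftFrontier hole = []
leftFrontier (within _ xs C _ _) = frontiers xs ++ leftFrontier C
rightFrontier hole = []
rightFrontier (within _ _ C ys _) = rightFrontier C ++ frontiers ys

frontier-plug : ∀ {n} (C : Context n) X →
  frontier (plug C X) ≡ leftFrontier C ++ frontier X ++ rightFrontier C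
frontier-plug hole X = sym (++-identityʳ (frontier X))
frontier-plug {n} (within _ xs C ys _) X = begin
  frontiers (xs ++ plug C X ∷ ys)                       ≡⟨ frontiers-++ xs (plug C X ∷ ys) ⟩
  F xs ++ frontier (plug C X) ++ F ys                   ≡⟨ cong (λ w → F xs ++ w ++ F ys) (frontier-plug C X) ⟩
  F xs ++ (L ++ frontier X ++ R) ++ F ys                ≡⟨ cong (F xs ++_) (++-assoc L _ (F ys)) ⟩
  F xs ++ L ++ (frontier X ++ R) ++ F ys                ≡⟨ cong (λ w → F xs ++ L ++ w) (++-assoc (frontier X) R (F ys)) ⟩
  F xs ++ L ++ frontier X ++ R ++ F ys                  ≡⟨ ++-assoc (F xs) L _ ⟨
  (F xs ++ L) ++ frontier X ++ R ++ F ys                ∎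
  where
  open ≡-Reasoning
  F : List (PQTree n) → List (Fin n)
  F = frontiers
  L R : List (Fin n)
  L = leftFrontier C
  R = rightFrontier C

module _ {n : ℕ} where

  Before⇒∈ˡ : ∀ {xs : List (Fin n)} {a b} → Before xs a b → a ∈ xs
  Before⇒∈ˡ (us , _ , refl , _) = ∈-insert us

  Before⇒∈ʳ : ∀ {xs : List (Fin n)} {a b} → Before xs a b → b ∈ xs
  Before⇒∈ʳ (us , _ , refl , b∈vs) = ∈-++⁺ʳ us (there b∈vs)

  Before-++⁺ʳ : ∀ {X : List (Fin n)} Y {a b} → Before X a b → Before (X ++ Y) a b
  Before-++⁺ʳ Y (us , vs , refl , b∈vs) = us , vs ++ Y , ++-assoc us (_ ∷ vs) Y , ∈-++⁺ˡ b∈vs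

  Before-++⁺ˡ : ∀ (X : List (Fin n)) {Y a b} → Before Y a b → Before (X ++ Y) a b
  Before-++⁺ˡ X (us , vs , refl , b∈vs) = X ++ us , vs , sym (++-assoc X us (_ ∷ vs)) , b∈vs

  Before-++⁺ : ∀ {X Y : List (Fin n)} {a b} → a ∈ X → b ∈ Y → Before (X ++ Y) a b
  Before-++⁺ {Y = Y} a∈X b∈Y with ∈-∃++ a∈X
  ... | us , ws , refl = us , ws ++ Y , ++-assoc us (_ ∷ ws) Y , ∈-++⁺ʳ ws b∈Y

  Before-++⁻ : ∀ (X : List (Fin n)) {Y a b} → Before (X ++ Y) a b →
    Before X a b ⊎ ((a ∈ X × b ∈ Y) ⊎ Before Y a b)
  Before-++⁻ X (us , vs , e , b∈vs) with ++-≡-++-∷ X e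
  ... | inj₁ (m , _ , e′) = inj₂ (inj₂ (m , vs , e′ , b∈vs))
  ... | inj₂ (m , refl , refl) with ∈-++⁻ m b∈vs
  ...   | inj₁ b∈m = inj₁ (us , m , refl , b∈m)
  ...   | inj₂ b∈Y = inj₂ (inj₁ (∈-insert us , b∈Y))

  Unique-++⇒Disjoint : ∀ (X : List (Fin n)) {Y} → Unique (X ++ Y) → Disjoint X Y
  Unique-++⇒Disjoint (x ∷ X) (x∉ ∷ _) (here refl , a∈Y) = All.lookup x∉ (∈-++⁺ʳ X a∈Y) refl
  Unique-++⇒Disjoint (x ∷ X) (_ ∷ u) (there a∈X , a∈Y) = Unique-++⇒Disjoint X u (a∈X , a∈Y)

  Unique-++⁻ʳ : ∀ (X : List (Fin n)) {Y} → Unique (X ++ Y) → Unique Y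
  Unique-++⁻ʳ [] u = u
  Unique-++⁻ʳ (_ ∷ X) (_ ∷ u) = Unique-++⁻ʳ X u

  Before-block-↭ : ∀ L {A B : List (Fin n)} R {a b} → A ↭ B → (a ∈ B → b ∈ B → Before B a b) →
    Before (L ++ A ++ R) a b → Before (L ++ B ++ R) a b
  Before-block-↭ L {A} {B} R A↭B inside-B h with Before-++⁻ L h
  ... | inj₁ h-L = Before-++⁺ʳ (B ++ R) h-L
  ... | inj₂ (inj₁ (a∈L , b∈AR)) with ∈-++⁻ A b∈AR
  ...   | inj₁ b∈A = Before-++⁺ a∈L (∈-++⁺ˡ (∈-resp-↭ A↭B b∈A))
  ...   | inj₂ b∈R = Before-++⁺ a∈L (∈-++⁺ʳ B b∈R)
  Before-block-↭ L {A} {B} R A↭B inside-B h | inj₂ (inj₂ h-AR) with Before-++⁻ A h-AR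
  ... | inj₁ h-A = Before-++⁺ˡ L (Before-++⁺ʳ R
                     (inside-B (∈-resp-↭ A↭B (Before⇒∈ˡ h-A)) (∈-resp-↭ A↭B (Before⇒∈ʳ h-A))))
  ... | inj₂ (inj₁ (a∈A , b∈R)) = Before-++⁺ˡ L (Before-++⁺ (∈-resp-↭ A↭B a∈A) b∈R)
  ... | inj₂ (inj₂ h-R) = Before-++⁺ˡ L (Before-++⁺ˡ B h-R)

  Before-block⁻ : ∀ L {B : List (Fin n)} R {a b} → Unique (L ++ B ++ R) → a ∈ B → b ∈ B →
    Before (L ++ B ++ R) a b → Before B a b
  Before-block⁻ L {B} R u a∈B b∈B h with Before-++⁻ L h
  ... | inj₁ h-L = ⊥-elim (Unique-++⇒Disjoint L u (Before⇒∈ˡ h-L , ∈-++⁺ˡ a∈B))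
  ... | inj₂ (inj₁ (a∈L , _)) = ⊥-elim (Unique-++⇒Disjoint L u (a∈L , ∈-++⁺ˡ a∈B))
  ... | inj₂ (inj₂ h-BR) with Before-++⁻ B h-BR
  ...   | inj₁ h-B = h-B
  ...   | inj₂ (inj₁ (_ , b∈R)) = ⊥-elim (Unique-++⇒Disjoint B (Unique-++⁻ʳ L u) (b∈B , b∈R))
  ...   | inj₂ (inj₂ h-R) = ⊥-elim (Unique-++⇒Disjoint B (Unique-++⁻ʳ L u) (a∈B , Before⇒∈ˡ h-R))

Before-frontier-plug : ∀ {n} (C : Context n) X {a b} →
  a <[ plug C X ] b ⇔ Before (leftFrontier C ++ frontier X ++ rightFrontier C) a b
Before-frontier-plug C X {a} {b} = mk⇔
  (subst (λ xs → Before xs a b) (frontier-plug C X))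
  (subst (λ xs → Before xs a b) (sym (frontier-plug C X)))

mainTheorem1 : (n : ℕ) (T : PQTree n) → IsPQTreeOn T →
    (_◁_ : Fin n → Fin n → Set) → IsStrictPartialOrder _≡_ _◁_ →
    (S : PQTree n) → SubtreeOf S T →
    Σ (PQTree n) (λ T' → Reordering T T' × Compatible _◁_ T') →
    (S' : PQTree n) → Reordering S S' → LocallyCompatible _◁_ S' →
    Σ (PQTree n) (λ T'' → Reordering T T'' × Compatible _◁_ T'' ×
      (∀ (a b : Fin n) → a ∈ frontier S → b ∈ frontier S →
        (a <[ T'' ] b ⇔ a <[ S' ] b)))
mainTheorem1 n T T-on _◁_ _ S S⊆T (T′ , T↝T′ , T′-compatible) S′ S↝S′ S′-compatible
  with C , refl ← SubtreeOf⇒plug S⊆T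
  with reorderedPlug C′ S₁ refl S↝S₁ C↝C′ ← Reordering⇒ReorderedPlug C S T↝T′ =
  plug C′ S′ , T↝T″ , compatible , same-order
  where
  open Equivalence
  L R : List (Fin n)
  L = leftFrontier C′
  R = rightFrontier C′
  T↝T″ : Reordering (plug C S) (plug C′ S′)
  T↝T″ = plug-Reordering C S↝S′ ◅◅ C↝C′ S′
  S↭S′ : frontier S ↭ frontier S′
  S↭S′ = Reordering⇒frontier-↭ S↝S′
  S₁↭S′ : frontier S₁ ↭ frontier S′
  S₁↭S′ = ↭-trans (↭-sym (Reordering⇒frontier-↭ S↝S₁)) S↭S′

  compatible : Compatible _◁_ (plug C′ S′)
  compatible a b a◁b = from (Before-frontier-plug C′ S′)
    (Before-block-↭ L R S₁↭S′ (λ a∈ b∈ → S′-compatible a b a∈ b∈ a◁b)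
      (to (Before-frontier-plug C′ S₁) (T′-compatible a b a◁b)))

  same-order : ∀ a b → a ∈ frontier S → b ∈ frontier S → a <[ plug C′ S′ ] b ⇔ a <[ S′ ] b
  same-order a b a∈S b∈S = mk⇔
    (λ h → Before-block⁻ L R distinct (∈-resp-↭ S↭S′ a∈S) (∈-resp-↭ S↭S′ b∈S)
             (to (Before-frontier-plug C′ S′) h))
    (λ h → from (Before-frontier-plug C′ S′) (Before-++⁺ˡ L (Before-++⁺ʳ R h)))
    where
    distinct : Unique (L ++ frontier S′ ++ R)
    distinct = subst Unique (frontier-plug C′ S′)
      (IsPQTreeOn⇒Unique {T = plug C′ S′} (IsPQTreeOn-Reordering T-on T↝T″))
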